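{- For every integer $n\geq 2$, the $n$-book graph $B_n=K_{1,n}\square P_2$ satisfies $$D_l(B_n)=D(B_n)=\lceil \sqrt{n}\rceil .$$
   Context: $B_n$ is the Cartesian product of the star $K_{1,n}$ and the path $P_2$. Its vertices are $v_0,v_1,\dots,v_n,w_0,w_1,\dots,w_n$. The edges are $v_0v_i$ and $w_0w_i$ for $1\le i\le n$, and $v_iw_i$ for $0\le i\le n$. A labeling $\phi:V(G)\to\{1,\dots,r\}$ of a graph $G$ is distinguishing if the only automorphism $\sigma$ of $G$ with $\phi(\sigma(x))=\phi(x)$ for all $x\in V(G)$ is the identity. The distinguishing number $D(G)$ is the least $r$ such that $G$ has a distinguishing labeling with $r$ labels. A list assignment $L=\{L(v)\}_{v\in V(G)}$ gives each vertex a set of labels. A distinguishing $L$-labeling is a distinguishing labeling in which each vertex $v$ receives a label from $L(v)$. The list distinguishing number $D_l(G)$ is the least $k$ such that every list assignment with $|L(v)|=k$ for all $v$ admits a distinguishing $L$-labeling. -}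

module Defs where

open import Data.Nat using (ℕ; suc; _≤_; _<_; _*_)
open import Data.Fin using (Fin; zero; suc)
open import Data.Product using (_×_; Σ; _,_)
import Data.Product
open import Data.Sum using (_⊎_)
open import Data.List using (List; length)
open import Data.List.Membership.Propositional using (_∈_)
open import Data.List.Relation.Unary.Unique.Propositional using (Unique)
open import Relation.Binary.PropositionalEquality using (_≡_; _≢_)
open import Relation.Nullary using (¬_)
open import Level using (0ℓ)

record Graph : Set₁ where
  field
    V   : Set
    Adj : V → V → Set
open Graph public

record Aut (G : Graph) : Set where
  field
    to      : V G → V G
    from    : V G → V G
    to-from : ∀ x → to (from x) ≡ x
    from-to : ∀ x → from (to x) ≡ x
    pres    : ∀ x y → Adj G x y → Adj G (to x) (to y)
    refl'   : ∀ x y → Adj G (to x) (to y) → Adj G x y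
open Aut public

Distinguishing : (G : Graph) {A : Set} → (V G → A) → Set
Distinguishing G φ = (σ : Aut G) → (∀ x → φ (to σ x) ≡ φ x) → ∀ x → to σ x ≡ x

HasDistLabeling : Graph → ℕ → Set
HasDistLabeling G r = Σ (V G → Fin r) λ φ → Distinguishing G φ

ListAssignment : Graph → ℕ → Set
ListAssignment G k = Σ (V G → List ℕ) λ L → ∀ v → Unique (L v) × length (L v) ≡ k

ListDistinguishable : Graph → ℕ → Set
ListDistinguishable G k = (LA : ListAssignment G k) →
  let L = Data.Product.proj₁ LA in
  Σ (V G → ℕ) λ φ → (∀ v → φ v ∈ L v) × Distinguishing G φ

IsLeast : (ℕ → Set) → ℕ → Set
IsLeast P m = P m × (∀ k → k < m → ¬ P k)

IsDistNumber : Graph → ℕ → Set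
IsDistNumber G r = IsLeast (HasDistLabeling G) r

IsListDistNumber : Graph → ℕ → Set
IsListDistNumber G k = IsLeast (ListDistinguishable G) k

IsCeilSqrt : ℕ → ℕ → Set
IsCeilSqrt n c = IsLeast (λ m → n ≤ m * m) c

-- The book graph B_n = K_{1,n} □ P_2.
-- Vertex (zero , i) is v_i, (suc zero , i) is w_i; index zero is the star centre.
data BookAdj (n : ℕ) : Fin 2 × Fin (suc n) → Fin 2 × Fin (suc n) → Set where
  spoke-out : ∀ a (i : Fin n) → BookAdj n (a , zero) (a , suc i)
  spoke-in  : ∀ a (i : Fin n) → BookAdj n (a , suc i) (a , zero)
  rung      : ∀ {a b} (i : Fin (suc n)) → a ≢ b → BookAdj n (a , i) (b , i)

Book : ℕ → Graph
Book n = record { V = Fin 2 × Fin (suc n) ; Adj = BookAdj n }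

-- Call the pair of labels on the two leaves v_k, w_k of page k the profile
-- of page k.  The proof has two halves.
--
-- Lower bound.  Any permutation of the pages is an automorphism of B_n.  If
-- two pages had the same profile, swapping them would preserve the labels,
-- so a distinguishing labeling has pairwise distinct profiles; with labels
-- from Fin r this is an injection Fin n → Fin r × Fin r, whence n ≤ r².
--
-- Upper bound.  Conversely a labeling is distinguishing as soon as the hubs
-- v_0, w_0 get different labels and the profiles are distinct: the hubs are
-- the only vertices with three neighbours, so they are fixed, and then every
-- page is mapped to a page with the same profile.  Given lists of size c
-- with n ≤ c², such a labeling is found greedily: each page chooses a
-- profile from the c² pairs of its lists avoiding the profiles chosen
-- so far.  Ordinary labelings are the special case of constant lists, so
-- both numbers equal the least c with n ≤ c², i.e. ⌈√n⌉.
module Submission where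

open import Defs
open import Data.Nat using (ℕ; zero; suc; _≤_; _<_; _*_; _+_; z≤n; s≤s; 2+)
import Data.Nat.Properties as ℕ
open import Data.Fin using (Fin; zero; suc; toℕ; fromℕ<; combine)
import Data.Fin.Properties as Fin
open import Data.Fin.Permutation using (Permutation′; _⟨$⟩ʳ_; _⟨$⟩ˡ_; inverseʳ; inverseˡ; transpose)
import Data.Fin.Permutation.Components as PC
open import Data.Product using (_×_; Σ; _,_; proj₁; proj₂)
open import Data.Product.Properties using (≡-dec)
open import Data.Sum using (_⊎_; inj₁; inj₂)
open import Data.List using (List; []; _∷_; [_]; _++_; length; upTo; cartesianProduct; lookup; map; tabulate)
open import Data.List.Properties using (length-upTo; length-++; length-map; length-tabulate)
open import Data.List.Relation.Unary.Any using (here; index)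
open import Data.List.Relation.Unary.All using (All; all?)
import Data.List.Relation.Unary.All as All
open import Data.List.Relation.Unary.All.Properties using (¬All⇒Any¬)
open import Data.List.Relation.Unary.AllPairs using (_∷_)
open import Data.List.Membership.Propositional using (_∈_; _∉_; find)
open import Data.List.Membership.Propositional.Properties using (∈-upTo⁻; ∈-lookup; ∈-cartesianProduct⁻; ∈-tabulate⁺)
import Data.List.Membership.DecPropositional as DecMembership
import Data.List.Membership.Setoid.Properties as SetoidMembership
open import Data.List.Relation.Unary.Unique.Propositional using (Unique)
open import Data.List.Relation.Unary.Unique.Propositional.Properties using (upTo⁺; cartesianProduct⁺)
open import Function.Base using (_∘_)
open import Function.Definitions using (Injective)
open import Relation.Binary.Definitions using (DecidableEquality)
open import Relation.Binary.PropositionalEquality using (_≡_; _≢_; refl; sym; trans; cong; cong₂; subst; subst₂; setoid; module ≡-Reasoning)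
open import Relation.Nullary using (¬_; yes; no; contradiction)
open import Relation.Nullary.Decidable using (dec-true)

-- Two mutually inverse adjacency-preserving maps form an automorphism;
-- reflection of adjacency follows from preservation by the inverse.
mkAut : (G : Graph) (f g : V G → V G) → (∀ x → f (g x) ≡ x) → (∀ x → g (f x) ≡ x) →
        (∀ x y → Adj G x y → Adj G (f x) (f y)) →
        (∀ x y → Adj G x y → Adj G (g x) (g y)) → Aut G
mkAut G f g fg gf f-adj g-adj = record
  { to = f ; from = g ; to-from = fg ; from-to = gf ; pres = f-adj
  ; refl' = λ x y fx~fy → subst₂ (Adj G) (gf x) (gf y) (g-adj (f x) (f y) fx~fy) }

aut-injective : ∀ {G} (σ : Aut G) → Injective _≡_ _≡_ (to σ)
aut-injective σ {x} {y} σx≡σy =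
  trans (sym (from-to σ x)) (trans (cong (from σ) σx≡σy) (from-to σ y))

HasThreeNeighbours : (G : Graph) → V G → Set
HasThreeNeighbours G x = Σ (V G) λ y₁ → Σ (V G) λ y₂ → Σ (V G) λ y₃ →
  Adj G x y₁ × Adj G x y₂ × Adj G x y₃ × y₁ ≢ y₂ × y₁ ≢ y₃ × y₂ ≢ y₃

aut-preserves-three : ∀ {G} (σ : Aut G) x → HasThreeNeighbours G x → HasThreeNeighbours G (to σ x)
aut-preserves-three σ x (y₁ , y₂ , y₃ , a₁ , a₂ , a₃ , d₁₂ , d₁₃ , d₂₃) =
  to σ y₁ , to σ y₂ , to σ y₃ , pres σ _ _ a₁ , pres σ _ _ a₂ , pres σ _ _ a₃ ,
  d₁₂ ∘ aut-injective σ , d₁₃ ∘ aut-injective σ , d₂₃ ∘ aut-injective σ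

pageMap : ∀ {n} → (Fin n → Fin n) → V (Book n) → V (Book n)
pageMap h (a , zero)  = a , zero
pageMap h (a , suc k) = a , suc (h k)

pageMap-adj : ∀ {n} (h : Fin n → Fin n) x y → BookAdj n x y → BookAdj n (pageMap h x) (pageMap h y)
pageMap-adj h _ _ (spoke-out a k) = spoke-out a (h k)
pageMap-adj h _ _ (spoke-in a k)  = spoke-in a (h k)
pageMap-adj h _ _ (rung zero a≢b)    = rung zero a≢b
pageMap-adj h _ _ (rung (suc k) a≢b) = rung (suc (h k)) a≢b

pageMap-inverse : ∀ {n} (h g : Fin n → Fin n) → (∀ k → h (g k) ≡ k) →
                  ∀ x → pageMap h (pageMap g x) ≡ x
pageMap-inverse h g hg (a , zero)  = refl
pageMap-inverse h g hg (a , suc k) = cong (λ j → a , suc j) (hg k)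

pageAut : ∀ {n} → Permutation′ n → Aut (Book n)
pageAut π = mkAut (Book _) (pageMap (π ⟨$⟩ʳ_)) (pageMap (π ⟨$⟩ˡ_))
  (pageMap-inverse _ _ (λ k → inverseʳ π))
  (pageMap-inverse _ _ (λ k → inverseˡ π))
  (pageMap-adj _) (pageMap-adj _)

profile : ∀ {n} {X : Set} → (V (Book n) → X) → Fin n → X × X
profile φ k = φ (zero , suc k) , φ (suc zero , suc k)

transpose-invariant : ∀ {n} {X : Set} (f : Fin n → X) (i j : Fin n) → f i ≡ f j →
                      ∀ k → f (PC.transpose i j k) ≡ f k
transpose-invariant f i j fi≡fj k with k Fin.≟ i
... | yes refl = sym fi≡fj
... | no _ with k Fin.≟ j
...   | yes refl = fi≡fj
...   | no _     = refl

transpose-sends : ∀ {n} (i j : Fin n) → PC.transpose i j i ≡ j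
transpose-sends i j rewrite dec-true (i Fin.≟ i) refl = refl

-- Distinguishing labelings give distinct profiles: otherwise swapping the
-- two pages is a nontrivial label-preserving automorphism.
distinguishing⇒profile-injective : ∀ {n} {X : Set} (φ : V (Book n) → X) →
  Distinguishing (Book n) φ → Injective _≡_ _≡_ (profile φ)
distinguishing⇒profile-injective φ dist {i} {j} same-profile =
  trans (sym (Fin.suc-injective (cong proj₂ i-fixed))) (transpose-sends i j)
  where
  same-leaf : ∀ a → φ (a , suc i) ≡ φ (a , suc j)
  same-leaf zero       = cong proj₁ same-profile
  same-leaf (suc zero) = cong proj₂ same-profile
  swap-preserves : ∀ x → φ (to (pageAut (transpose i j)) x) ≡ φ x
  swap-preserves (a , zero)  = refl
  swap-preserves (a , suc k) = transpose-invariant (λ l → φ (a , suc l)) i j (same-leaf a) k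
  i-fixed : (zero , suc (PC.transpose i j i)) ≡ (zero , suc i)
  i-fixed = dist (pageAut (transpose i j)) swap-preserves (zero , suc i)

lower-bound : ∀ n r → HasDistLabeling (Book n) r → n ≤ r * r
lower-bound n r (φ , dist) = Fin.injective⇒≤ {f = code} code-injective
  where
  code : Fin n → Fin (r * r)
  code k = combine (φ (zero , suc k)) (φ (suc zero , suc k))
  code-injective : Injective _≡_ _≡_ code
  code-injective eq with Fin.combine-injective _ _ _ _ eq
  ... | e₀ , e₁ = distinguishing⇒profile-injective φ dist (cong₂ _,_ e₀ e₁)

other : Fin 2 → Fin 2
other zero       = suc zero
other (suc zero) = zero

≢⇒other : ∀ {a b : Fin 2} → a ≢ b → b ≡ other a
≢⇒other {zero}     {zero}     a≢b = contradiction refl a≢b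
≢⇒other {zero}     {suc zero} _   = refl
≢⇒other {suc zero} {zero}     _   = refl
≢⇒other {suc zero} {suc zero} a≢b = contradiction refl a≢b

≢-other : ∀ (a : Fin 2) → a ≢ other a
≢-other zero       ()
≢-other (suc zero) ()

leaf-neighbours : ∀ {n} {a : Fin 2} {k : Fin n} {y} → BookAdj n (a , suc k) y →
                  y ≡ (a , zero) ⊎ y ≡ (other a , suc k)
leaf-neighbours (spoke-in a k)     = inj₁ refl
leaf-neighbours (rung (suc k) a≢b) = inj₂ (cong (_, suc k) (≢⇒other a≢b))

leaf-lacks-three : ∀ {n} (a : Fin 2) (k : Fin n) → ¬ HasThreeNeighbours (Book n) (a , suc k)
leaf-lacks-three a k (y₁ , y₂ , y₃ , a₁ , a₂ , a₃ , d₁₂ , d₁₃ , d₂₃)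
  with leaf-neighbours a₁ | leaf-neighbours a₂ | leaf-neighbours a₃
... | inj₁ p | inj₁ q | _      = d₁₂ (trans p (sym q))
... | inj₂ p | inj₂ q | _      = d₁₂ (trans p (sym q))
... | inj₁ p | inj₂ q | inj₁ r = d₁₃ (trans p (sym r))
... | inj₁ p | inj₂ q | inj₂ r = d₂₃ (trans q (sym r))
... | inj₂ p | inj₁ q | inj₁ r = d₂₃ (trans q (sym r))
... | inj₂ p | inj₁ q | inj₂ r = d₁₃ (trans p (sym r))

hub-has-three : ∀ m (a : Fin 2) → HasThreeNeighbours (Book (2+ m)) (a , zero)
hub-has-three m a = (a , suc zero) , (a , suc (suc zero)) , (other a , zero) ,
  spoke-out a zero , spoke-out a (suc zero) , rung zero (≢-other a) ,
  (λ ()) , (λ ()) , (λ ())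

module Rigidity {m : ℕ} {X : Set} (φ : V (Book (2+ m)) → X)
  (hubs-differ : φ (zero , zero) ≢ φ (suc zero , zero))
  (profile-injective : Injective _≡_ _≡_ (profile φ))
  (σ : Aut (Book (2+ m))) (preserves : ∀ x → φ (to σ x) ≡ φ x) where

  hub-label-injective : ∀ a b → φ (a , zero) ≡ φ (b , zero) → a ≡ b
  hub-label-injective zero       zero       _ = refl
  hub-label-injective zero       (suc zero) e = contradiction e hubs-differ
  hub-label-injective (suc zero) zero       e = contradiction (sym e) hubs-differ
  hub-label-injective (suc zero) (suc zero) _ = refl

  -- σ maps hubs to hubs, as only hubs have three neighbours, and so fixes
  -- each hub because their labels differ.
  hub-fixed : ∀ a → to σ (a , zero) ≡ (a , zero)
  hub-fixed a with to σ (a , zero) in eq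
  ... | b , suc k = contradiction (subst (HasThreeNeighbours (Book (2+ m))) eq (aut-preserves-three σ _ (hub-has-three m a)))
                                  (leaf-lacks-three b k)
  ... | b , zero  = cong (_, zero) (hub-label-injective b a (trans (cong φ (sym eq)) (preserves (a , zero))))

  -- A leaf stays on its side: its image is adjacent to the fixed hub of that side.
  leaf-stays-on-side : ∀ a k → Σ (Fin (2+ m)) λ j → to σ (a , suc k) ≡ (a , suc j)
  leaf-stays-on-side a k with to σ (a , suc k) in eq
  ... | b , zero with aut-injective σ (trans eq (sym (hub-fixed b)))
  ...   | ()
  leaf-stays-on-side a k | b , suc j
    with leaf-neighbours (subst₂ (BookAdj _) eq (hub-fixed a) (pres σ _ _ (spoke-in a k)))
  ...   | inj₁ refl = j , refl

  -- Both leaves of a page move to one page with the same profile, so to the same page.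
  page-fixed : ∀ k → to σ (zero , suc k) ≡ (zero , suc k) × to σ (suc zero , suc k) ≡ (suc zero , suc k)
  page-fixed k with leaf-stays-on-side zero k | leaf-stays-on-side (suc zero) k
  ... | j₀ , e₀ | j₁ , e₁
    with leaf-neighbours (subst₂ (BookAdj _) e₀ e₁ (pres σ _ _ (rung {a = zero} {b = suc zero} (suc k) (λ ()))))
  ...   | inj₂ refl with profile-injective (cong₂ _,_ (trans (cong φ (sym e₀)) (preserves _))
                                                       (trans (cong φ (sym e₁)) (preserves _)))
  ...     | refl = e₀ , e₁

  identity : ∀ x → to σ x ≡ x
  identity (a , zero)          = hub-fixed a
  identity (zero , suc k)      = proj₁ (page-fixed k)
  identity (suc zero , suc k)  = proj₂ (page-fixed k)

rigid-labeling : ∀ {m} {X : Set} (φ : V (Book (2+ m)) → X) →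
  φ (zero , zero) ≢ φ (suc zero , zero) → Injective _≡_ _≡_ (profile φ) →
  Distinguishing (Book (2+ m)) φ
rigid-labeling φ hubs-differ profile-injective σ preserves =
  Rigidity.identity φ hubs-differ profile-injective σ preserves

unique-lookup-injective : ∀ {A : Set} (xs : List A) → Unique xs → Injective _≡_ _≡_ (lookup xs)
unique-lookup-injective (x ∷ xs) (_ ∷ _)      {zero}  {zero}  _ = refl
unique-lookup-injective (x ∷ xs) (x∉ ∷ _)     {zero}  {suc j} e = contradiction e (All.lookup x∉ (∈-lookup j))
unique-lookup-injective (x ∷ xs) (x∉ ∷ _)     {suc i} {zero}  e = contradiction (sym e) (All.lookup x∉ (∈-lookup i))
unique-lookup-injective (x ∷ xs) (_ ∷ unique) {suc i} {suc j} e = cong suc (unique-lookup-injective xs unique e)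

unique-⊆⇒length≤ : ∀ {A : Set} (xs ys : List A) → Unique xs → All (_∈ ys) xs → length xs ≤ length ys
unique-⊆⇒length≤ {A} xs ys unique xs⊆ys = Fin.injective⇒≤ {f = position} position-injective
  where
  position : Fin (length xs) → Fin (length ys)
  position i = index (All.lookup xs⊆ys (∈-lookup i))
  position-injective : Injective _≡_ _≡_ position
  position-injective eq = unique-lookup-injective xs unique
    (SetoidMembership.index-injective (setoid A) (All.lookup xs⊆ys (∈-lookup _)) (All.lookup xs⊆ys (∈-lookup _)) eq)

module _ {A : Set} (_≟_ : DecidableEquality A) where
  open DecMembership _≟_ using (_∈?_)

  fresh : (xs ys : List A) → Unique xs → length ys < length xs → Σ A λ x → x ∈ xs × x ∉ ys
  fresh xs ys unique shorter with all? (_∈? ys) xs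
  ... | yes xs⊆ys = contradiction (unique-⊆⇒length≤ xs ys unique xs⊆ys) (ℕ.<⇒≱ shorter)
  ... | no ¬xs⊆ys = find (¬All⇒Any¬ (_∈? ys) xs ¬xs⊆ys)

  distinct-representatives : ∀ m (P : Fin m → List A) → (∀ k → Unique (P k)) → (∀ k → m ≤ length (P k)) →
    Σ (Fin m → A) λ g → (∀ k → g k ∈ P k) × Injective _≡_ _≡_ g
  distinct-representatives zero P _ _ = (λ ()) , (λ ()) , λ {i} → contradiction i λ ()
  distinct-representatives (suc m) P unique long
    with distinct-representatives m (λ k → P (suc k)) (λ k → unique (suc k))
                                  (λ k → ℕ.≤-trans (ℕ.n≤1+n m) (long (suc k)))
  ... | g , g∈P , g-injective
    with fresh (P zero) (tabulate g) (unique zero)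
               (subst (_< length (P zero)) (sym (length-tabulate g)) (long zero))
  ...   | x , x∈P , x∉g = g′ , g′∈P , g′-injective
    where
    g′ : Fin (suc m) → A
    g′ zero    = x
    g′ (suc k) = g k
    g′∈P : ∀ k → g′ k ∈ P k
    g′∈P zero    = x∈P
    g′∈P (suc k) = g∈P k
    g′-injective : Injective _≡_ _≡_ g′
    g′-injective {zero}  {zero}  _ = refl
    g′-injective {zero}  {suc j} e = contradiction (subst (_∈ tabulate g) (sym e) (∈-tabulate⁺ j)) x∉g
    g′-injective {suc i} {zero}  e = contradiction (subst (_∈ tabulate g) e (∈-tabulate⁺ i)) x∉g
    g′-injective {suc i} {suc j} e = cong suc (g-injective e)

length-cartesianProduct : ∀ {A B : Set} (xs : List A) (ys : List B) →
  length (cartesianProduct xs ys) ≡ length xs * length ys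
length-cartesianProduct []       ys = refl
length-cartesianProduct (x ∷ xs) ys = begin
  length (map (x ,_) ys ++ cartesianProduct xs ys)  ≡⟨ length-++ (map (x ,_) ys) ⟩
  length (map (x ,_) ys) + length (cartesianProduct xs ys)
    ≡⟨ cong₂ _+_ (length-map (x ,_) ys) (length-cartesianProduct xs ys) ⟩
  length ys + length xs * length ys  ∎
  where
  open ≡-Reasoning

two≤c : ∀ m c → 2+ m ≤ c * c → 2 ≤ c
two≤c m zero ()
two≤c m (suc zero) (s≤s ())
two≤c m (suc (suc c)) _ = s≤s (s≤s z≤n)

upper-bound : ∀ m c → 2+ m ≤ c * c → ListDistinguishable (Book (2+ m)) c
upper-bound m c n≤c² (L , L-ok) = φ , φ∈L , rigid-labeling φ hubs-differ g-injective
  where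
  unique : ∀ v → Unique (L v)
  unique v = proj₁ (L-ok v)
  size : ∀ v → length (L v) ≡ c
  size v = proj₂ (L-ok v)
  -- Every list has c ≥ 2 entries, so avoiding at most one label is possible.
  fewer-than-c : ∀ v (ys : List ℕ) → length ys < 2 → length ys < length (L v)
  fewer-than-c v ys ys<2 = subst (_ <_) (sym (size v)) (ℕ.<-≤-trans ys<2 (two≤c m c n≤c²))
  hub₀ : Σ ℕ λ x → x ∈ L (zero , zero) × x ∉ []
  hub₀ = fresh ℕ._≟_ (L (zero , zero)) [] (unique _) (fewer-than-c _ [] (s≤s z≤n))
  p : ℕ
  p = proj₁ hub₀
  hub₁ : Σ ℕ λ x → x ∈ L (suc zero , zero) × x ∉ [ p ]
  hub₁ = fresh ℕ._≟_ (L (suc zero , zero)) [ p ] (unique _) (fewer-than-c _ [ p ] (s≤s (s≤s z≤n)))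
  q : ℕ
  q = proj₁ hub₁
  hubs-differ : p ≢ q
  hubs-differ p≡q = proj₂ (proj₂ hub₁) (here (sym p≡q))
  pairs : Fin (2+ m) → List (ℕ × ℕ)
  pairs k = cartesianProduct (L (zero , suc k)) (L (suc zero , suc k))
  enough-pairs : ∀ k → 2+ m ≤ length (pairs k)
  enough-pairs k = subst (2+ m ≤_) (sym (trans (length-cartesianProduct (L (zero , suc k)) (L (suc zero , suc k)))
                                              (cong₂ _*_ (size _) (size _)))) n≤c²
  reps : Σ (Fin (2+ m) → ℕ × ℕ) λ g → (∀ k → g k ∈ pairs k) × Injective _≡_ _≡_ g
  reps = distinct-representatives (≡-dec ℕ._≟_ ℕ._≟_) (2+ m) pairs
           (λ k → cartesianProduct⁺ (unique _) (unique _)) enough-pairs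
  g : Fin (2+ m) → ℕ × ℕ
  g = proj₁ reps
  g-injective : Injective _≡_ _≡_ g
  g-injective = proj₂ (proj₂ reps)
  φ : V (Book (2+ m)) → ℕ
  φ (zero , zero)      = p
  φ (suc zero , zero)  = q
  φ (zero , suc k)     = proj₁ (g k)
  φ (suc zero , suc k) = proj₂ (g k)
  φ∈L : ∀ v → φ v ∈ L v
  φ∈L (zero , zero)      = proj₁ (proj₂ hub₀)
  φ∈L (suc zero , zero)  = proj₁ (proj₂ hub₁)
  φ∈L (zero , suc k)     = proj₁ (∈-cartesianProduct⁻ (L _) (L _) (proj₁ (proj₂ reps) k))
  φ∈L (suc zero , suc k) = proj₂ (∈-cartesianProduct⁻ (L _) (L _) (proj₁ (proj₂ reps) k))

list⇒ordinary : ∀ G k → ListDistinguishable G k → HasDistLabeling G k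
list⇒ordinary G k list-dist with list-dist ((λ _ → upTo k) , λ _ → upTo⁺ k , length-upTo k)
... | φ , φ<k , dist = ψ , ψ-dist
  where
  ψ : V G → Fin k
  ψ v = fromℕ< (∈-upTo⁻ (φ<k v))
  toℕ-ψ : ∀ v → toℕ (ψ v) ≡ φ v
  toℕ-ψ v = Fin.toℕ-fromℕ< (∈-upTo⁻ (φ<k v))
  ψ-dist : Distinguishing G ψ
  ψ-dist σ preserves = dist σ λ x → trans (sym (toℕ-ψ (to σ x))) (trans (cong toℕ (preserves x)) (toℕ-ψ x))

mainTheorem2 : (n : ℕ) → 2 ≤ n → (c : ℕ) → IsCeilSqrt n c →
    IsListDistNumber (Book n) c × IsDistNumber (Book n) c
mainTheorem2 (2+ m) (s≤s (s≤s z≤n)) c (n≤c² , c-least) =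
  (list-dist , λ k k<c k-list → c-least k k<c (lower-bound _ k (list⇒ordinary _ k k-list))) ,
  (list⇒ordinary _ c list-dist , λ k k<c k-dist → c-least k k<c (lower-bound _ k k-dist))
  where
  list-dist : ListDistinguishable (Book (2+ m)) c
  list-dist = upper-bound m c n≤c²
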